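{- Let $G$ be a finite simple graph, let $\Gamma\subseteq\Omega(G)$ and $\emptyset\neq\Gamma'\subseteq\mathrm{MaxCritIndep}(G)$ be such that for every $A\in\Gamma'$ there exists $S\in\Gamma$ with $A\subseteq S$. If $\bigcap\Gamma$ is a critical set, then: (i) $\bigcap\Gamma\subseteq\bigcap\Gamma'$; (ii) $\Gamma'\vartriangleleft\Gamma$; (iii) $\left|\bigcap\Gamma'\right|+\left|\bigcup\Gamma'\right|\leq\left|\bigcap\Gamma\right|+\left|\bigcup\Gamma\right|$; (iv) if, in addition, $\bigcup\Gamma'=\bigcup\Gamma$, then $\bigcap\Gamma'=\bigcap\Gamma$.
   Context: For a graph $G$ and $A\subseteq V(G)$: $N(A)=\{v\in V(G): v \text{ has a neighbor in } A\}$. A set is independent if no two of its vertices are adjacent; $\mathrm{Ind}(G)$ is the family of independent sets and $\Omega(G)$ the family of all maximum independent sets. The difference of $X\subseteq V(G)$ is $d(X)=|X|-|N(X)|$. An independent set $A$ is critical if $d(A)=\max\{d(I):I\in\mathrm{Ind}(G)\}$. A maximum critical independent set is a critical independent set of maximum cardinality among all critical independent sets; $\mathrm{MaxCritIndep}(G)$ denotes the family of all of them. For collections of sets $\Gamma,\Gamma'$, write $\Gamma'\vartriangleleft\Gamma$ if $\bigcup\Gamma'\subseteq\bigcup\Gamma$ and $\bigcap\Gamma\subseteq\bigcap\Gamma'$. -}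

module Defs where

open import Data.Nat using (ℕ)
import Data.Nat
open import Data.Bool using (Bool; true; false; _∧_; _∨_)
open import Data.Fin using (Fin)
open import Data.Fin.Subset using (Subset; _∈_; _⊆_; _∩_; _∪_; ∣_∣) renaming (⊤ to full; ⊥ to empty)
open import Data.Vec using (tabulate; zipWith; foldr′)
open import Data.Integer using (ℤ; +_; _-_; _≤_)
open import Data.List using (List)
import Data.List as List
import Data.List.Membership.Propositional as LM
open import Data.Product using (_×_)
open import Relation.Binary.PropositionalEquality using (_≡_)

record Graph (n : ℕ) : Set where
  field
    adj    : Fin n → Fin n → Bool
    sym    : ∀ u v → adj u v ≡ adj v u
    irrefl : ∀ v → adj v v ≡ false
open Graph public

module _ {n : ℕ} (G : Graph n) where

  -- N(A) = { v : v has a neighbour in A }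
  N : Subset n → Subset n
  N A = tabulate (λ v → foldr′ _∨_ false (zipWith _∧_ A (tabulate (adj G v))))

  d : Subset n → ℤ
  d X = + ∣ X ∣ - + ∣ N X ∣

  Independent : Subset n → Set
  Independent A = ∀ u v → u ∈ A → v ∈ A → adj G u v ≡ false

  MaximumIndependent : Subset n → Set
  MaximumIndependent S = Independent S × (∀ I → Independent I → ∣ I ∣ Data.Nat.≤ ∣ S ∣)

  Critical : Subset n → Set
  Critical X = ∀ I → Independent I → d I ≤ d X

  CriticalIndependent : Subset n → Set
  CriticalIndependent A = Independent A × Critical A

  MaximumCriticalIndependent : Subset n → Set
  MaximumCriticalIndependent A =
    CriticalIndependent A × (∀ B → CriticalIndependent B → ∣ B ∣ Data.Nat.≤ ∣ A ∣)

module _ {n : ℕ} where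
  -- union and intersection of a finite family of subsets (⋂ [] = V, ⋃ [] = ∅)
  ⋃ : List (Subset n) → Subset n
  ⋃ = List.foldr _∪_ empty

  ⋂ : List (Subset n) → Subset n
  ⋂ = List.foldr _∩_ full

  _◁_ : List (Subset n) → List (Subset n) → Set
  Γ' ◁ Γ = (⋃ Γ' ⊆ ⋃ Γ) × (⋂ Γ ⊆ ⋂ Γ')

module Submission where

-- Theorem 2.7 (Γ ⊆ Ω(G), ∅ ≠ Γ' ⊆ MaxCritIndep(G), each A ∈ Γ' inside some S ∈ Γ,
-- ⋂Γ critical).  (i) rests on an absorption property: if X is critical,
-- A ∈ MaxCritIndep(G) and X ∪ A is independent, then X ⊆ A.  The difference d is supermodular,
-- d(X) + d(A) ≤ d(X ∪ A) + d(X ∩ A), and d(X ∩ A) ≤ d(X) because X is critical; hence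
-- d(A) ≤ d(X ∪ A), so X ∪ A is critical and maximality of |A| gives X ∪ A = A.
-- With X = ⋂Γ ⊆ S ⊇ A this yields ⋂Γ ⊆ A for every A ∈ Γ'; (ii) adds ⋃Γ' ⊆ ⋃Γ.
-- (iii) uses a counting bound: every independent Z satisfies
-- |Z| ≤ |Z ∩ ⋂Γ| + |⋃Γ ∩ N(Z)|, by induction on Γ from the one-set case (an independent
-- W disjoint from a maximum independent T has |W| ≤ |T ∩ N(W)|, as W ∪ (T − N(W)) is
-- independent).  For Z = ⋂Γ' the set ⋃Γ ∩ N(⋂Γ') misses ⋃Γ', which gives (iii);
-- (iv) follows from (i) and (iii) by comparing cardinalities.

open import Defs
open import Data.Nat using (ℕ; _+_; _≤_)
open import Data.Fin.Subset using (Subset; _⊆_; ∣_∣)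
open import Data.List using (List; [])
open import Data.List.Membership.Propositional using (_∈_)
open import Data.Product using (_×_; ∃-syntax)
open import Relation.Binary.PropositionalEquality using (_≡_; _≢_)

open import Data.Nat using (suc; s≤s; s≤s⁻¹)
import Data.Nat.Properties as ℕ
open import Data.Bool using (Bool; true; false; _∧_; _∨_)
open import Data.Bool.Properties using (∨-zeroʳ)
open import Data.Fin using (Fin; zero; suc)
open import Data.Fin.Subset using (_∩_; _∪_; ∁; _∉_; inside; outside; Empty)
  renaming (_∈_ to _∈ₛ_; ⊥ to ∅)
open import Data.Fin.Subset.Properties
  using (x∈p∩q⁺; x∈p∩q⁻; x∈p∪q⁺; x∈p∪q⁻; p∩q⊆p; p∩q⊆q; p⊆p∪q; q⊆p∪q;
         x∈∁p⇒x∉p; ∈⊤; ∉⊥; drop-∷-⊆; p⊆q⇒∣p∣≤∣q∣; Empty-unique; ∣⊥∣≡0)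
open import Data.Vec using (Vec; []; _∷_; lookup; tabulate; zipWith; foldr′; here; there)
open import Data.Vec.Properties using ([]=⇒lookup; lookup⇒[]=; lookup∘tabulate)
open import Data.Integer as ℤ using (ℤ; -_; +≤+)
  renaming (_+_ to _⊕_; _-_ to _⊝_)
import Data.Integer.Properties as ℤ
open import Data.Integer.Tactic.RingSolver using (solve-∀)
open import Data.List using (_∷_)
open import Data.List.Relation.Unary.Any using (here; there)
open import Data.Product using (Σ; _,_; proj₁; proj₂)
open import Data.Sum using (inj₁; inj₂; [_,_]′)
open import Relation.Nullary using (contradiction)
open import Relation.Binary.PropositionalEquality using (refl; trans; cong; cong₂; subst; module ≡-Reasoning)
  renaming (sym to ≡-sym)

∣p∪q∣+∣p∩q∣≡∣p∣+∣q∣ : ∀ {n} (p q : Subset n) → ∣ p ∪ q ∣ + ∣ p ∩ q ∣ ≡ ∣ p ∣ + ∣ q ∣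
∣p∪q∣+∣p∩q∣≡∣p∣+∣q∣ []            []            = refl
∣p∪q∣+∣p∩q∣≡∣p∣+∣q∣ (outside ∷ p) (outside ∷ q) = ∣p∪q∣+∣p∩q∣≡∣p∣+∣q∣ p q
∣p∪q∣+∣p∩q∣≡∣p∣+∣q∣ (inside  ∷ p) (outside ∷ q) = cong suc (∣p∪q∣+∣p∩q∣≡∣p∣+∣q∣ p q)
∣p∪q∣+∣p∩q∣≡∣p∣+∣q∣ (outside ∷ p) (inside  ∷ q) =
  trans (cong suc (∣p∪q∣+∣p∩q∣≡∣p∣+∣q∣ p q)) (≡-sym (ℕ.+-suc ∣ p ∣ ∣ q ∣))
∣p∪q∣+∣p∩q∣≡∣p∣+∣q∣ (inside  ∷ p) (inside  ∷ q) = cong suc (begin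
  ∣ p ∪ q ∣ + suc ∣ p ∩ q ∣   ≡⟨ ℕ.+-suc (∣ p ∪ q ∣) (∣ p ∩ q ∣) ⟩
  suc (∣ p ∪ q ∣ + ∣ p ∩ q ∣) ≡⟨ cong suc (∣p∪q∣+∣p∩q∣≡∣p∣+∣q∣ p q) ⟩
  suc (∣ p ∣ + ∣ q ∣)         ≡⟨ ℕ.+-suc ∣ p ∣ ∣ q ∣ ⟨
  ∣ p ∣ + suc ∣ q ∣           ∎)
  where open ≡-Reasoning

∣p∣≡∣p∩q∣+∣p∩∁q∣ : ∀ {n} (p q : Subset n) → ∣ p ∣ ≡ ∣ p ∩ q ∣ + ∣ p ∩ ∁ q ∣
∣p∣≡∣p∩q∣+∣p∩∁q∣ []            []            = refl
∣p∣≡∣p∩q∣+∣p∩∁q∣ (outside ∷ p) (_       ∷ q) = ∣p∣≡∣p∩q∣+∣p∩∁q∣ p q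
∣p∣≡∣p∩q∣+∣p∩∁q∣ (inside  ∷ p) (inside  ∷ q) = cong suc (∣p∣≡∣p∩q∣+∣p∩∁q∣ p q)
∣p∣≡∣p∩q∣+∣p∩∁q∣ (inside  ∷ p) (outside ∷ q) =
  trans (cong suc (∣p∣≡∣p∩q∣+∣p∩∁q∣ p q)) (≡-sym (ℕ.+-suc ∣ p ∩ q ∣ ∣ p ∩ ∁ q ∣))

∪-least : ∀ {n} {p q r : Subset n} → p ⊆ r → q ⊆ r → p ∪ q ⊆ r
∪-least {p = p} {q} p⊆r q⊆r x∈p∪q = [ p⊆r , q⊆r ]′ (x∈p∪q⁻ p q x∈p∪q)

disjoint⇒∣p∣+∣q∣≤∣r∣ : ∀ {n} {p q r : Subset n} →
  p ⊆ r → q ⊆ r → (∀ {x} → x ∈ₛ p → x ∉ q) → ∣ p ∣ + ∣ q ∣ ≤ ∣ r ∣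
disjoint⇒∣p∣+∣q∣≤∣r∣ {n} {p} {q} {r} p⊆r q⊆r disjoint = begin
  ∣ p ∣ + ∣ q ∣         ≡⟨ ∣p∪q∣+∣p∩q∣≡∣p∣+∣q∣ p q ⟨
  ∣ p ∪ q ∣ + ∣ p ∩ q ∣ ≡⟨ cong (λ (s : Subset n) → ∣ p ∪ q ∣ + ∣ s ∣) (Empty-unique p∩q-empty) ⟩
  ∣ p ∪ q ∣ + ∣ ∅ {n} ∣ ≡⟨ cong (∣ p ∪ q ∣ +_) (∣⊥∣≡0 n) ⟩
  ∣ p ∪ q ∣ + 0         ≡⟨ ℕ.+-identityʳ ∣ p ∪ q ∣ ⟩
  ∣ p ∪ q ∣             ≤⟨ p⊆q⇒∣p∣≤∣q∣ (∪-least p⊆r q⊆r) ⟩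
  ∣ r ∣                 ∎
  where
  open ℕ.≤-Reasoning
  p∩q-empty : Empty (p ∩ q)
  p∩q-empty (x , x∈p∩q) = let (x∈p , x∈q) = x∈p∩q⁻ p q x∈p∩q in disjoint x∈p x∈q

⊆∧∣q∣≤∣p∣⇒≡ : ∀ {n} {p q : Subset n} → p ⊆ q → ∣ q ∣ ≤ ∣ p ∣ → p ≡ q
⊆∧∣q∣≤∣p∣⇒≡ {p = []}          {[]}          _   _ = refl
⊆∧∣q∣≤∣p∣⇒≡ {p = outside ∷ p} {outside ∷ q} p⊆q h = cong (outside ∷_) (⊆∧∣q∣≤∣p∣⇒≡ (drop-∷-⊆ p⊆q) h)
⊆∧∣q∣≤∣p∣⇒≡ {p = outside ∷ p} {inside  ∷ q} p⊆q h =
  contradiction h (ℕ.<⇒≱ (s≤s (p⊆q⇒∣p∣≤∣q∣ (drop-∷-⊆ p⊆q))))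
⊆∧∣q∣≤∣p∣⇒≡ {p = inside  ∷ p} {outside ∷ q} p⊆q h with p⊆q here
... | ()
⊆∧∣q∣≤∣p∣⇒≡ {p = inside  ∷ p} {inside  ∷ q} p⊆q h =
  cong (inside ∷_) (⊆∧∣q∣≤∣p∣⇒≡ (drop-∷-⊆ p⊆q) (s≤s⁻¹ h))

module _ {n : ℕ} where

  ⋂-lower : ∀ {Γ : List (Subset n)} {S} → S ∈ Γ → ⋂ Γ ⊆ S
  ⋂-lower {T ∷ Γ} (here refl) x∈⋂ = proj₁ (x∈p∩q⁻ T (⋂ Γ) x∈⋂)
  ⋂-lower {T ∷ Γ} (there S∈Γ) x∈⋂ = ⋂-lower S∈Γ (proj₂ (x∈p∩q⁻ T (⋂ Γ) x∈⋂))

  ⋂-greatest : ∀ (Γ : List (Subset n)) {P} → (∀ A → A ∈ Γ → P ⊆ A) → P ⊆ ⋂ Γ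
  ⋂-greatest []      _     _   = ∈⊤
  ⋂-greatest (T ∷ Γ) P⊆all x∈P =
    x∈p∩q⁺ (P⊆all T (here refl) x∈P , ⋂-greatest Γ (λ A A∈Γ → P⊆all A (there A∈Γ)) x∈P)

  ∈⋃⁺ : ∀ {Γ : List (Subset n)} {S x} → S ∈ Γ → x ∈ₛ S → x ∈ₛ ⋃ Γ
  ∈⋃⁺ (here refl) x∈S = x∈p∪q⁺ (inj₁ x∈S)
  ∈⋃⁺ (there S∈Γ) x∈S = x∈p∪q⁺ (inj₂ (∈⋃⁺ S∈Γ x∈S))

  ∈⋃⁻ : ∀ (Γ : List (Subset n)) {x} → x ∈ₛ ⋃ Γ → ∃[ S ] (S ∈ Γ × x ∈ₛ S)
  ∈⋃⁻ []      x∈⋃ = contradiction x∈⋃ ∉⊥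
  ∈⋃⁻ (T ∷ Γ) x∈⋃ with x∈p∪q⁻ T (⋃ Γ) x∈⋃
  ... | inj₁ x∈T = T , here refl , x∈T
  ... | inj₂ x∈⋃Γ = let (S , S∈Γ , x∈S) = ∈⋃⁻ Γ x∈⋃Γ in S , there S∈Γ , x∈S

some-common⁻ : ∀ {m} (a w : Vec Bool m) → foldr′ _∨_ false (zipWith _∧_ a w) ≡ true →
  Σ (Fin m) λ i → lookup a i ≡ true × lookup w i ≡ true
some-common⁻ []          []          ()
some-common⁻ (true  ∷ a) (true  ∷ w) _ = zero , refl , refl
some-common⁻ (true  ∷ a) (false ∷ w) h = let (i , p , q) = some-common⁻ a w h in suc i , p , q
some-common⁻ (false ∷ a) (_     ∷ w) h = let (i , p , q) = some-common⁻ a w h in suc i , p , q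

some-common⁺ : ∀ {m} (a w : Vec Bool m) (i : Fin m) → lookup a i ≡ true → lookup w i ≡ true →
  foldr′ _∨_ false (zipWith _∧_ a w) ≡ true
some-common⁺ (true ∷ a) (true ∷ w) zero    refl refl = refl
some-common⁺ (b    ∷ a) (c    ∷ w) (suc i) p    q    =
  trans (cong ((b ∧ c) ∨_) (some-common⁺ a w i p q)) (∨-zeroʳ (b ∧ c))

module _ {n : ℕ} (G : Graph n) where

  private
    neighbourTest : Subset n → Fin n → Bool
    neighbourTest A v = foldr′ _∨_ false (zipWith _∧_ A (tabulate (adj G v)))

  ∈N⁻ : ∀ {A x} → x ∈ₛ N G A → ∃[ y ] (y ∈ₛ A × adj G x y ≡ true)
  ∈N⁻ {A} {x} x∈NA =
    let (y , y∈A , xy) = some-common⁻ A (tabulate (adj G x))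
                           (trans (≡-sym (lookup∘tabulate (neighbourTest A) x)) ([]=⇒lookup x∈NA))
    in y , lookup⇒[]= y A y∈A , trans (≡-sym (lookup∘tabulate (adj G x) y)) xy

  ∈N⁺ : ∀ {A x y} → y ∈ₛ A → adj G x y ≡ true → x ∈ₛ N G A
  ∈N⁺ {A} {x} {y} y∈A xy = lookup⇒[]= x (N G A)
    (trans (lookup∘tabulate (neighbourTest A) x)
           (some-common⁺ A (tabulate (adj G x)) y ([]=⇒lookup y∈A)
                         (trans (lookup∘tabulate (adj G x) y) xy)))

  N-mono : ∀ {P Q} → P ⊆ Q → N G P ⊆ N G Q
  N-mono P⊆Q x∈NP = let (y , y∈P , xy) = ∈N⁻ x∈NP in ∈N⁺ (P⊆Q y∈P) xy

  N-∪ : ∀ P Q → N G (P ∪ Q) ⊆ N G P ∪ N G Q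
  N-∪ P Q x∈N = let (y , y∈P∪Q , xy) = ∈N⁻ x∈N in
    x∈p∪q⁺ ([ (λ y∈P → inj₁ (∈N⁺ y∈P xy)) , (λ y∈Q → inj₂ (∈N⁺ y∈Q xy)) ]′ (x∈p∪q⁻ P Q y∈P∪Q))

  N-∩ : ∀ P Q → N G (P ∩ Q) ⊆ N G P ∩ N G Q
  N-∩ P Q x∈N = x∈p∩q⁺ (N-mono (p∩q⊆p P Q) x∈N , N-mono (p∩q⊆q P Q) x∈N)

  independent-⊆ : ∀ {P Q} → P ⊆ Q → Independent G Q → Independent G P
  independent-⊆ P⊆Q indQ u v u∈P v∈P = indQ u v (P⊆Q u∈P) (P⊆Q v∈P)

  independent⇒∉N : ∀ {S Z} → Independent G S → Z ⊆ S → ∀ {v} → v ∈ₛ S → v ∉ N G Z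
  independent⇒∉N indS Z⊆S v∈S v∈NZ with ∈N⁻ v∈NZ
  ... | y , y∈Z , vy with trans (≡-sym vy) (indS _ _ v∈S (Z⊆S y∈Z))
  ...   | ()

  ∉N⇒non-adjacent : ∀ {Z u v} → v ∈ₛ Z → u ∉ N G Z → adj G u v ≡ false
  ∉N⇒non-adjacent {u = u} {v} v∈Z u∉NZ with adj G u v in uv
  ... | false = refl
  ... | true  = contradiction (∈N⁺ v∈Z uv) u∉NZ

ℤ-+-cancelʳ-≤ : ∀ k {i j : ℤ} → i ⊕ k ℤ.≤ j ⊕ k → i ℤ.≤ j
ℤ-+-cancelʳ-≤ k {i} {j} h = begin
  i             ≡⟨ add-sub i k ⟨
  i ⊕ k ⊝ k     ≤⟨ ℤ.+-monoˡ-≤ (- k) h ⟩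
  j ⊕ k ⊝ k     ≡⟨ add-sub j k ⟩
  j             ∎
  where
  open ℤ.≤-Reasoning
  add-sub : ∀ a b → a ⊕ b ⊝ b ≡ a
  add-sub = solve-∀

module _ {n : ℕ} (G : Graph n) where

  private
    subtract-sums : ∀ a b c e → (a ⊝ b) ⊕ (c ⊝ e) ≡ (a ⊕ c) ⊝ (b ⊕ e)
    subtract-sums = solve-∀

    d-+ : ∀ P Q → d G P ⊕ d G Q ≡ ℤ.+ (∣ P ∣ + ∣ Q ∣) ⊝ ℤ.+ (∣ N G P ∣ + ∣ N G Q ∣)
    d-+ P Q = trans (subtract-sums (ℤ.+ ∣ P ∣) (ℤ.+ ∣ N G P ∣) (ℤ.+ ∣ Q ∣) (ℤ.+ ∣ N G Q ∣))
      (≡-sym (cong₂ _⊝_ (ℤ.pos-+ ∣ P ∣ ∣ Q ∣) (ℤ.pos-+ ∣ N G P ∣ ∣ N G Q ∣)))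

  -- Supermodularity of d: N(P ∪ Q) = N(P) ∪ N(Q) and N(P ∩ Q) ⊆ N(P) ∩ N(Q).
  d-supermodular : ∀ P Q → d G P ⊕ d G Q ℤ.≤ d G (P ∪ Q) ⊕ d G (P ∩ Q)
  d-supermodular P Q = begin
    d G P ⊕ d G Q
      ≡⟨ d-+ P Q ⟩
    ℤ.+ (∣ P ∣ + ∣ Q ∣) ⊝ ℤ.+ (∣ NP ∣ + ∣ NQ ∣)
      ≡⟨ cong (λ s → ℤ.+ s ⊝ ℤ.+ (∣ NP ∣ + ∣ NQ ∣)) (∣p∪q∣+∣p∩q∣≡∣p∣+∣q∣ P Q) ⟨
    ℤ.+ (∣ P ∪ Q ∣ + ∣ P ∩ Q ∣) ⊝ ℤ.+ (∣ NP ∣ + ∣ NQ ∣)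
      ≤⟨ ℤ.+-monoʳ-≤ (ℤ.+ (∣ P ∪ Q ∣ + ∣ P ∩ Q ∣)) (ℤ.neg-mono-≤ (+≤+ N-bound)) ⟩
    ℤ.+ (∣ P ∪ Q ∣ + ∣ P ∩ Q ∣) ⊝ ℤ.+ (∣ N G (P ∪ Q) ∣ + ∣ N G (P ∩ Q) ∣)
      ≡⟨ d-+ (P ∪ Q) (P ∩ Q) ⟨
    d G (P ∪ Q) ⊕ d G (P ∩ Q) ∎
    where
    open ℤ.≤-Reasoning
    NP = N G P
    NQ = N G Q
    N-bound : ∣ N G (P ∪ Q) ∣ + ∣ N G (P ∩ Q) ∣ ≤ ∣ NP ∣ + ∣ NQ ∣
    N-bound = ℕ.≤-trans
      (ℕ.+-mono-≤ (p⊆q⇒∣p∣≤∣q∣ (N-∪ G P Q)) (p⊆q⇒∣p∣≤∣q∣ (N-∩ G P Q)))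
      (ℕ.≤-reflexive (∣p∪q∣+∣p∩q∣≡∣p∣+∣q∣ NP NQ))

  critical-absorbed : ∀ {X A} → Critical G X → MaximumCriticalIndependent G A →
    Independent G (X ∪ A) → X ⊆ A
  critical-absorbed {X} {A} critX ((indA , critA) , maxA) indX∪A =
    subst (X ⊆_) (≡-sym A≡X∪A) (p⊆p∪q A)
    where
    dA≤dX∪A : d G A ℤ.≤ d G (X ∪ A)
    dA≤dX∪A = ℤ-+-cancelʳ-≤ (d G X) (begin
      d G A ⊕ d G X             ≡⟨ ℤ.+-comm (d G A) (d G X) ⟩
      d G X ⊕ d G A             ≤⟨ d-supermodular X A ⟩
      d G (X ∪ A) ⊕ d G (X ∩ A) ≤⟨ ℤ.+-monoʳ-≤ (d G (X ∪ A)) (critX (X ∩ A) indX∩A) ⟩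
      d G (X ∪ A) ⊕ d G X       ∎)
      where
      open ℤ.≤-Reasoning
      indX∩A : Independent G (X ∩ A)
      indX∩A = independent-⊆ G (λ x∈ → p⊆p∪q A (p∩q⊆p X A x∈)) indX∪A
    critX∪A : Critical G (X ∪ A)
    critX∪A I indI = ℤ.≤-trans (critA I indI) dA≤dX∪A
    A≡X∪A : A ≡ X ∪ A
    A≡X∪A = ⊆∧∣q∣≤∣p∣⇒≡ (q⊆p∪q X A) (maxA (X ∪ A) (indX∪A , critX∪A))

module _ {n : ℕ} (G : Graph n) where

  -- An independent set W avoiding a maximum independent set T has at most
  -- |T ∩ N(W)| elements: W ∪ (T − N(W)) is independent, hence no larger than T.
  avoiding-maximum-bound : ∀ {T W} → MaximumIndependent G T → Independent G W →
    (∀ {x} → x ∈ₛ W → x ∉ T) → ∣ W ∣ ≤ ∣ T ∩ N G W ∣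
  avoiding-maximum-bound {T} {W} (indT , maxT) indW W-avoids-T =
    ℕ.+-cancelʳ-≤ (∣ T' ∣) (∣ W ∣) (∣ T ∩ N G W ∣) (begin
      ∣ W ∣ + ∣ T' ∣          ≤⟨ disjoint⇒∣p∣+∣q∣≤∣r∣ (p⊆p∪q T') (q⊆p∪q W T')
                                   (λ x∈W x∈T' → W-avoids-T x∈W (p∩q⊆p T _ x∈T')) ⟩
      ∣ W ∪ T' ∣              ≤⟨ maxT (W ∪ T') indW∪T' ⟩
      ∣ T ∣                   ≡⟨ ∣p∣≡∣p∩q∣+∣p∩∁q∣ T (N G W) ⟩
      ∣ T ∩ N G W ∣ + ∣ T' ∣  ∎)
    where
    open ℕ.≤-Reasoning
    T' = T ∩ ∁ (N G W)
    ∉NW : ∀ {x} → x ∈ₛ T' → x ∉ N G W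
    ∉NW x∈T' = x∈∁p⇒x∉p (p∩q⊆q T _ x∈T')
    indW∪T' : Independent G (W ∪ T')
    indW∪T' u v u∈ v∈ with x∈p∪q⁻ W T' u∈ | x∈p∪q⁻ W T' v∈
    ... | inj₁ u∈W  | inj₁ v∈W  = indW u v u∈W v∈W
    ... | inj₁ u∈W  | inj₂ v∈T' = trans (Graph.sym G u v) (∉N⇒non-adjacent G u∈W (∉NW v∈T'))
    ... | inj₂ u∈T' | inj₁ v∈W  = ∉N⇒non-adjacent G v∈W (∉NW u∈T')
    ... | inj₂ u∈T' | inj₂ v∈T' = indT u v (p∩q⊆p T _ u∈T') (p∩q⊆p T _ v∈T')

  -- For Γ = T ∷ Γ₀ the part Z' of Z ∩ ⋂Γ₀ outside T
  -- is charged to T ∩ N(Z'), which is disjoint from ⋃Γ₀ ∩ N(Z).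
  counting-bound : ∀ (Γ : List (Subset n)) → (∀ S → S ∈ Γ → MaximumIndependent G S) →
    ∀ {Z} → Independent G Z → ∣ Z ∣ ≤ ∣ Z ∩ ⋂ Γ ∣ + ∣ ⋃ Γ ∩ N G Z ∣
  counting-bound [] _ {Z} _ =
    ℕ.≤-trans (p⊆q⇒∣p∣≤∣q∣ {p = Z} (λ x∈Z → x∈p∩q⁺ (x∈Z , ∈⊤))) (ℕ.m≤m+n (∣ Z ∩ ⋂ [] ∣) _)
  counting-bound (T ∷ Γ) maxT∷Γ {Z} indZ = begin
    ∣ Z ∣                                          ≤⟨ counting-bound Γ maxΓ indZ ⟩
    ∣ Z ∩ I ∣ + ∣ U ∩ N G Z ∣                       ≡⟨ cong (_+ ∣ U ∩ N G Z ∣) (∣p∣≡∣p∩q∣+∣p∩∁q∣ (Z ∩ I) T) ⟩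
    ∣ (Z ∩ I) ∩ T ∣ + ∣ Z' ∣ + ∣ U ∩ N G Z ∣        ≡⟨ ℕ.+-assoc (∣ (Z ∩ I) ∩ T ∣) (∣ Z' ∣) _ ⟩
    ∣ (Z ∩ I) ∩ T ∣ + (∣ Z' ∣ + ∣ U ∩ N G Z ∣)      ≤⟨ ℕ.+-mono-≤ (p⊆q⇒∣p∣≤∣q∣ regroup)
                                                         (ℕ.+-monoˡ-≤ ∣ U ∩ N G Z ∣ Z'-bound) ⟩
    ∣ Z ∩ (T ∩ I) ∣ + (∣ T ∩ N G Z' ∣ + ∣ U ∩ N G Z ∣) ≤⟨ ℕ.+-monoʳ-≤ ∣ Z ∩ (T ∩ I) ∣ charged-disjointly ⟩
    ∣ Z ∩ (T ∩ I) ∣ + ∣ (T ∪ U) ∩ N G Z ∣           ∎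
    where
    open ℕ.≤-Reasoning
    I = ⋂ Γ
    U = ⋃ Γ
    Z' = (Z ∩ I) ∩ ∁ T
    maxΓ : ∀ S → S ∈ Γ → MaximumIndependent G S
    maxΓ S S∈Γ = maxT∷Γ S (there S∈Γ)
    Z'⊆Z∩I : Z' ⊆ Z ∩ I
    Z'⊆Z∩I = p∩q⊆p (Z ∩ I) (∁ T)
    Z'⊆Z : Z' ⊆ Z
    Z'⊆Z x∈Z' = p∩q⊆p Z I (Z'⊆Z∩I x∈Z')
    regroup : (Z ∩ I) ∩ T ⊆ Z ∩ (T ∩ I)
    regroup x∈ = let (x∈Z∩I , x∈T) = x∈p∩q⁻ (Z ∩ I) T x∈ ; (x∈Z , x∈I) = x∈p∩q⁻ Z I x∈Z∩I
                 in x∈p∩q⁺ (x∈Z , x∈p∩q⁺ (x∈T , x∈I))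
    Z'-bound : ∣ Z' ∣ ≤ ∣ T ∩ N G Z' ∣
    Z'-bound = avoiding-maximum-bound (maxT∷Γ T (here refl)) (independent-⊆ G Z'⊆Z indZ)
                 (λ x∈Z' → x∈∁p⇒x∉p (p∩q⊆q (Z ∩ I) (∁ T) x∈Z'))
    -- A vertex of ⋃Γ lies in an independent S ∈ Γ containing Z', so it is not in N(Z').
    charged-disjointly : ∣ T ∩ N G Z' ∣ + ∣ U ∩ N G Z ∣ ≤ ∣ (T ∪ U) ∩ N G Z ∣
    charged-disjointly = disjoint⇒∣p∣+∣q∣≤∣r∣
      (λ x∈ → let (x∈T , x∈NZ') = x∈p∩q⁻ T _ x∈ in x∈p∩q⁺ (p⊆p∪q U x∈T , N-mono G Z'⊆Z x∈NZ'))
      (λ x∈ → let (x∈U , x∈NZ) = x∈p∩q⁻ U _ x∈ in x∈p∩q⁺ (q⊆p∪q T U x∈U , x∈NZ))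
      (λ x∈T∩NZ' x∈U∩NZ →
        let (S , S∈Γ , x∈S) = ∈⋃⁻ Γ (p∩q⊆p U _ x∈U∩NZ)
        in independent⇒∉N G (proj₁ (maxΓ S S∈Γ)) (λ y∈Z' → ⋂-lower S∈Γ (p∩q⊆q Z I (Z'⊆Z∩I y∈Z')))
             x∈S (p∩q⊆q T _ x∈T∩NZ'))

module _ {n : ℕ} (G : Graph n) {Γ Γ' : List (Subset n)}
         (maxΓ : ∀ S → S ∈ Γ → MaximumIndependent G S)
         (covered : ∀ A → A ∈ Γ' → ∃[ S ] (S ∈ Γ × A ⊆ S)) where

  intersection-absorbed : (∀ A → A ∈ Γ' → MaximumCriticalIndependent G A) → Critical G (⋂ Γ) → ⋂ Γ ⊆ ⋂ Γ'
  intersection-absorbed mciΓ' critX = ⋂-greatest Γ' λ A A∈Γ' →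
    let (S , S∈Γ , A⊆S) = covered A A∈Γ' in
    critical-absorbed G critX (mciΓ' A A∈Γ')
      (independent-⊆ G (∪-least (⋂-lower S∈Γ) A⊆S) (proj₁ (maxΓ S S∈Γ)))

  union-covered : ⋃ Γ' ⊆ ⋃ Γ
  union-covered x∈⋃Γ' =
    let (A , A∈Γ' , x∈A) = ∈⋃⁻ Γ' x∈⋃Γ' ; (S , S∈Γ , A⊆S) = covered A A∈Γ' in ∈⋃⁺ S∈Γ (A⊆S x∈A)

  -- (iii): the counting bound for Z = ⋂Γ', where ⋃Γ ∩ N(⋂Γ') misses ⋃Γ' because
  -- every A ∈ Γ' is independent and contains ⋂Γ'.
  cardinality-bound : (∀ A → A ∈ Γ' → Independent G A) → ∀ {A₀} → A₀ ∈ Γ' →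
    ∣ ⋂ Γ' ∣ + ∣ ⋃ Γ' ∣ ≤ ∣ ⋂ Γ ∣ + ∣ ⋃ Γ ∣
  cardinality-bound indΓ' A₀∈Γ' = begin
    ∣ Y ∣ + ∣ ⋃ Γ' ∣                    ≤⟨ ℕ.+-monoˡ-≤ ∣ ⋃ Γ' ∣ (counting-bound G Γ maxΓ indY) ⟩
    ∣ Y ∩ ⋂ Γ ∣ + ∣ ⋃ Γ ∩ N G Y ∣ + ∣ ⋃ Γ' ∣   ≡⟨ ℕ.+-assoc (∣ Y ∩ ⋂ Γ ∣) (∣ ⋃ Γ ∩ N G Y ∣) (∣ ⋃ Γ' ∣) ⟩
    ∣ Y ∩ ⋂ Γ ∣ + (∣ ⋃ Γ ∩ N G Y ∣ + ∣ ⋃ Γ' ∣) ≤⟨ ℕ.+-mono-≤ (p⊆q⇒∣p∣≤∣q∣ (p∩q⊆q Y (⋂ Γ))) disjoint-in-⋃Γ ⟩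
    ∣ ⋂ Γ ∣ + ∣ ⋃ Γ ∣                   ∎
    where
    open ℕ.≤-Reasoning
    Y = ⋂ Γ'
    indY : Independent G Y
    indY = independent-⊆ G (⋂-lower A₀∈Γ') (indΓ' _ A₀∈Γ')
    disjoint-in-⋃Γ : ∣ ⋃ Γ ∩ N G Y ∣ + ∣ ⋃ Γ' ∣ ≤ ∣ ⋃ Γ ∣
    disjoint-in-⋃Γ = disjoint⇒∣p∣+∣q∣≤∣r∣ (p∩q⊆p (⋃ Γ) (N G Y)) union-covered λ x∈ x∈⋃Γ' →
      let (A , A∈Γ' , x∈A) = ∈⋃⁻ Γ' x∈⋃Γ' in
      independent⇒∉N G (indΓ' A A∈Γ') (⋂-lower A∈Γ') x∈A (p∩q⊆q (⋃ Γ) (N G Y) x∈)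

theorem2p7 : {n : ℕ} (G : Graph n) (Γ Γ' : List (Subset n)) →
    (∀ S → S ∈ Γ → MaximumIndependent G S) →
    Γ' ≢ [] →
    (∀ A → A ∈ Γ' → MaximumCriticalIndependent G A) →
    (∀ A → A ∈ Γ' → ∃[ S ] (S ∈ Γ × A ⊆ S)) →
    Critical G (⋂ Γ) →
    (⋂ Γ ⊆ ⋂ Γ')
    × (Γ' ◁ Γ)
    × (∣ ⋂ Γ' ∣ + ∣ ⋃ Γ' ∣ ≤ ∣ ⋂ Γ ∣ + ∣ ⋃ Γ ∣)
    × (⋃ Γ' ≡ ⋃ Γ → ⋂ Γ' ≡ ⋂ Γ)
theorem2p7 G Γ []          _    Γ'≢[] _     _       _     = contradiction refl Γ'≢[]
theorem2p7 G Γ Γ'@(_ ∷ _) maxΓ _ mciΓ' covered critX =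
  ⋂Γ⊆⋂Γ' , (union-covered G maxΓ covered , ⋂Γ⊆⋂Γ') , bound , equal-unions⇒equal-intersections
  where
  ⋂Γ⊆⋂Γ' : ⋂ Γ ⊆ ⋂ Γ'
  ⋂Γ⊆⋂Γ' = intersection-absorbed G maxΓ covered mciΓ' critX
  bound : ∣ ⋂ Γ' ∣ + ∣ ⋃ Γ' ∣ ≤ ∣ ⋂ Γ ∣ + ∣ ⋃ Γ ∣
  bound = cardinality-bound G maxΓ covered (λ A A∈Γ' → proj₁ (proj₁ (mciΓ' A A∈Γ'))) (here refl)
  -- (iv): with equal unions, (iii) gives |⋂Γ'| ≤ |⋂Γ|, and (i) gives ⋂Γ ⊆ ⋂Γ'.
  equal-unions⇒equal-intersections : ⋃ Γ' ≡ ⋃ Γ → ⋂ Γ' ≡ ⋂ Γ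
  equal-unions⇒equal-intersections ⋃Γ'≡⋃Γ = ≡-sym (⊆∧∣q∣≤∣p∣⇒≡ ⋂Γ⊆⋂Γ'
    (ℕ.+-cancelʳ-≤ (∣ ⋃ Γ ∣) (∣ ⋂ Γ' ∣) (∣ ⋂ Γ ∣)
      (subst (λ V → ∣ ⋂ Γ' ∣ + ∣ V ∣ ≤ ∣ ⋂ Γ ∣ + ∣ ⋃ Γ ∣) ⋃Γ'≡⋃Γ bound)))
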